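{- Let $I\subseteq[n]$, $\overline J\subseteq[\overline n]$ be a valid pair, and let $i\in I$, $\overline j\in\overline J$ with $\mathrm{prec}(\overline j)=i$. Then the vertex $(\mathbf e_i,\mathbf e_{\overline j})$ of $\mathcal U_{I,\overline J}$ is a cone point (a vertex of every maximal simplex) of every triangulation of $\mathcal U_{I,\overline J}$ obtainable by the subdivision algebra.
   Context: Fix $n\ge1$, $[n]=\{1,\dots,n\}$, $[\overline n]=\{\overline1,\dots,\overline n\}$, ordered by $1\prec\overline1\prec2\prec\cdots\prec n\prec\overline n$. A pair $I\subseteq[n]$, $\overline J\subseteq[\overline n]$ is valid if $\min(I\sqcup\overline J)\in I$, $\max(I\sqcup\overline J)\in\overline J$. Define $\mathrm{prec}:\overline J\to[n]$: if in $\prec$ restricted to $I\sqcup\overline J$ the element $\overline j$ is immediately preceded by some $i\in I$, then $\mathrm{prec}(\overline j)=i$, otherwise $\mathrm{prec}(\overline j)=j$. Let $\mathrm{prec}(A(I,\overline J))$ be the simple directed graph on $I\cup\mathrm{prec}(\overline J)\subseteq[n]$ with edges $(i,\mathrm{prec}(\overline j))$ for $i\in I$, $\overline j\in\overline J$, $i<\mathrm{prec}(\overline j)$; $\min(H)$ deletes each edge $(i,j)$ of $H$ for which $H$ has a directed path from $i$ to $j$ with at least two edges; $G=G(I,\overline J)=\min(\mathrm{prec}(A(I,\overline J)))$. $\mathcal U_{I,\overline J}=\mathrm{conv}\{(\mathbf e_i,\mathbf e_{\overline j}):i\in I,\overline j\in\overline J,i\prec\overline j\}\subseteq\mathbb R^n\times\mathbb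 R^n$ (second factor with basis $\mathbf e_{\overline1},\dots,\mathbf e_{\overline n}$). $\widehat G$ has vertex set $V(G)\cup\{s,t\}$ and edges $E(G)\cup\{(s,i):i\in I\}\cup\{(\mathrm{prec}(\overline j),t):\overline j\in\overline J\}$; routes are directed $s$–$t$ paths, $\chi(R)\in\mathbb R^{E(\widehat G)}$ the indicator vector of route $R$; $\mathcal F_{\widehat G}=\mathrm{conv}\{\chi(R)\}$. Let $\varphi_1:\mathbb R^{E(\widehat G)}\to\mathbb R^{2n}$ be linear with $\varphi_1(\mathbf e_{(s,i)})=(\mathbf e_i,\mathbf 0)$, $\varphi_1(\mathbf e_{(\mathrm{prec}(\overline j),t)})=(\mathbf 0,\mathbf e_{\overline j})$, $\varphi_1(\mathbf e_e)=\mathbf 0$ for $e\in E(G)$; it maps $\mathcal F_{\widehat G}$ bijectively onto $\mathcal U_{I,\overline J}$. Subdivision algebra: polynomials in commuting $\beta$, $x_{ab}$ ($a<b$); $M_G=\prod_{(a,b)\in E(G)}x_{ab}$; a reduction at $x_{ij},x_{jk}$ ($i<j<k$) replaces, in each monomial divisible by $x_{ij}x_{jk}$, this factor by $x_{ik}x_{ij}+x_{jk}x_{ik}+\beta x_{ik}$; a reduced form of $M_G$ is the result of reductions from $M_G$ until no monomial is divisible by any $x_{ij}x_{jk}$, $i<j<k$. For a factor $x_{ab}$ of a monomial of a reduced form, $R_{ab}$ is the route $(s,a)$, the unique directed path in $G$ from $a$ to $b$, $(b,t)$. For a monomial $M$ of a reduced form $p$ not divisible by $\beta$, $\Delta_M=\mathrm{conv}(\{\chi(R_{ab}):x_{ab}\mid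 M\}\cup\{\chi(s,v,t):v\in I\cap\mathrm{prec}(\overline J)\})$. These $\Delta_M$ are the maximal simplices of a triangulation of $\mathcal F_{\widehat G}$; the triangulations of $\mathcal U_{I,\overline J}$ with maximal simplices $\varphi_1(\Delta_M)$, for some reduced form $p$ of $M_G$, are those obtainable by the subdivision algebra. -}

module Defs where

open import Data.Nat using (ℕ; zero; suc; _+_; _*_; _∸_; _≤_; _<_; _≤?_)
open import Data.Fin using (Fin; toℕ; _≟_)
open import Data.Fin.Subset using (Subset; _∈_)
open import Data.Bool using (Bool; true; false; if_then_else_; _∧_)
open import Data.Product using (Σ; Σ-syntax; _×_; _,_; proj₁; proj₂)
open import Data.Sum using (_⊎_)
open import Data.List using (List; []; _∷_; _++_; concatMap; foldr; map)
open import Relation.Nullary using (¬_; does)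
open import Relation.Binary.PropositionalEquality using (_≡_)
open import Relation.Binary.Construct.Closure.ReflexiveTransitive using (Star; ε; _◅_)
import Data.List.Membership.Propositional as Mem

-- Vertices k : Fin n stand for k+1 ∈ [n].  The total order ≺ on
-- [n] ⊔ [n̄] :  1 ≺ 1̄ ≺ 2 ≺ ... is encoded by the key 2k (unbarred) /
-- 2k+1 (barred).  An element is (k , b) with b = true meaning barred.

Elt : ℕ → Set
Elt n = Fin n × Bool

key : ∀ {n} → Elt n → ℕ
key (k , false) = 2 * toℕ k
key (k , true)  = suc (2 * toℕ k)

-- membership in I ⊔ J̄  (J : Subset n encodes J̄ ⊆ [n̄])
InU : ∀ {n} → Subset n → Subset n → Elt n → Set
InU I J (k , false) = k ∈ I
InU I J (k , true)  = k ∈ J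

IsMinU : ∀ {n} → Subset n → Subset n → Elt n → Set
IsMinU I J e = InU I J e × (∀ e' → InU I J e' → key e ≤ key e')

IsMaxU : ∀ {n} → Subset n → Subset n → Elt n → Set
IsMaxU I J e = InU I J e × (∀ e' → InU I J e' → key e' ≤ key e)

Valid : ∀ {n} → Subset n → Subset n → Set
Valid I J = (Σ[ e ∈ Elt _ ] (IsMinU I J e × proj₂ e ≡ false))
          × (Σ[ e ∈ Elt _ ] (IsMaxU I J e × proj₂ e ≡ true))

ImmPred : ∀ {n} → Subset n → Subset n → Fin n → Fin n → Set
ImmPred I J i j =
  i ∈ I × j ∈ J × key (i , false) < key (j , true)
  × (∀ e → InU I J e → ¬ (key (i , false) < key e × key e < key (j , true)))

-- Prec I J j p  :  prec(j̄) = p   (graph of the function prec)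
data Prec {n} (I J : Subset n) (j : Fin n) : Fin n → Set where
  imm  : ∀ {i} → ImmPred I J i j → Prec I J j i
  self : (∀ i → ¬ ImmPred I J i j) → Prec I J j j

-- edges of prec(A(I,J̄)) : (i , prec(j̄)) with i ∈ I, j̄ ∈ J̄, i < prec(j̄)
AEdge : ∀ {n} → Subset n → Subset n → Fin n → Fin n → Set
AEdge I J a b = a ∈ I × (Σ[ j ∈ Fin _ ] (j ∈ J × Prec I J j b)) × toℕ a < toℕ b

-- edges of G = min(prec(A(I,J̄))): edges with no directed path of ≥ 2 edges
GEdge : ∀ {n} → Subset n → Subset n → Fin n → Fin n → Set
GEdge I J a b = AEdge I J a b
  × ¬ (Σ[ c ∈ Fin _ ] Σ[ d ∈ Fin _ ]
         (AEdge I J a c × Star (AEdge I J) c d × AEdge I J d b))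

-- A monomial β^e ∏ x_ab^{m a b}; a polynomial is a
-- formal sum of monomials (a list; coefficients are positive, given by
-- repetition, so the monomials of p are exactly the list entries).

record Mono (n : ℕ) : Set where
  constructor mono
  field
    βe : ℕ
    xe : Fin n → Fin n → ℕ
open Mono public

Poly : ℕ → Set
Poly n = List (Mono n)

ex : ∀ {n} → Fin n → Fin n → Fin n → Fin n → ℕ
ex a b x y = if does (a ≟ x) ∧ does (b ≟ y) then 1 else 0

_⊕_ : ∀ {n} → (Fin n → Fin n → ℕ) → (Fin n → Fin n → ℕ) → Fin n → Fin n → ℕ
(f ⊕ g) x y = f x y + g x y

_⊖_ : ∀ {n} → (Fin n → Fin n → ℕ) → (Fin n → Fin n → ℕ) → Fin n → Fin n → ℕ
(f ⊖ g) x y = f x y ∸ g x y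

divides? : ∀ {n} → Fin n → Fin n → Fin n → Mono n → Bool
divides? i j k m = does (1 ≤? xe m i j) ∧ does (1 ≤? xe m j k)

-- replace x_ij x_jk by x_ik x_ij + x_jk x_ik + β x_ik
reduceMono : ∀ {n} → Fin n → Fin n → Fin n → Mono n → Poly n
reduceMono i j k m =
  if divides? i j k m
  then (mono (βe m) (r ⊕ (ex i k ⊕ ex i j))
        ∷ mono (βe m) (r ⊕ (ex j k ⊕ ex i k))
        ∷ mono (suc (βe m)) (r ⊕ ex i k) ∷ [])
  else (m ∷ [])
  where r = xe m ⊖ (ex i j ⊕ ex j k)

reduceAt : ∀ {n} → Fin n → Fin n → Fin n → Poly n → Poly n
reduceAt i j k p = concatMap (reduceMono i j k) p

data Step {n} : Poly n → Poly n → Set where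
  red : ∀ {p} (i j k : Fin n) → toℕ i < toℕ j → toℕ j < toℕ k
      → Step p (reduceAt i j k p)

IsReduced : ∀ {n} → Poly n → Set
IsReduced {n} p = ∀ (M : Mono n) → M Mem.∈ p → ∀ (i j k : Fin n)
  → toℕ i < toℕ j → toℕ j < toℕ k → ¬ (1 ≤ xe M i j × 1 ≤ xe M j k)

ReducedFormOf : ∀ {n} → Mono n → Poly n → Set
ReducedFormOf M₀ p = Star Step (M₀ ∷ []) p × IsReduced p

IsMG : ∀ {n} → Subset n → Subset n → Mono n → Set
IsMG I J M = βe M ≡ 0
  × (∀ a b → (GEdge I J a b → xe M a b ≡ 1) × (¬ GEdge I J a b → xe M a b ≡ 0))

-- Ĝ, routes and φ₁.
-- Edges of Ĝ: (s,a) ; (a,b) ∈ E(G) ; (prec(j̄),t) named by j̄ (prec is injective).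

data HatEdge (n : ℕ) : Set where
  sE : Fin n → HatEdge n
  gE : Fin n → Fin n → HatEdge n
  tE : Fin n → HatEdge n

Point : ℕ → Set
Point n = (Fin n → ℕ) × (Fin n → ℕ)

𝐞 : ∀ {n} → Fin n → Fin n → ℕ
𝐞 a x = if does (a ≟ x) then 1 else 0

𝟎 : ∀ {n} → Fin n → ℕ
𝟎 _ = 0

_+P_ : ∀ {n} → Point n → Point n → Point n
(u , v) +P (u' , v') = (λ x → u x + u' x) , (λ x → v x + v' x)

_≈P_ : ∀ {n} → Point n → Point n → Set
(u , v) ≈P (u' , v') = (∀ x → u x ≡ u' x) × (∀ x → v x ≡ v' x)

φ₁e : ∀ {n} → HatEdge n → Point n
φ₁e (sE a)   = 𝐞 a , 𝟎
φ₁e (gE _ _) = 𝟎 , 𝟎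
φ₁e (tE j)   = 𝟎 , 𝐞 j

-- φ₁(χ(R)) for a route R given as its list of (distinct) edges:
-- χ(R) = Σ_{e ∈ R} 𝐞_e, and φ₁ is linear.
φ₁χ : ∀ {n} → List (HatEdge n) → Point n
φ₁χ R = foldr _+P_ (𝟎 , 𝟎) (map φ₁e R)

pathEdges : ∀ {n} {E : Fin n → Fin n → Set} {a b} → Star E a b → List (HatEdge n)
pathEdges ε = []
pathEdges (_◅_ {i} {j} _ p) = gE i j ∷ pathEdges p

-- v is one of the vertices of φ₁(Δ_M), i.e. v = φ₁(χ(R_ab)) for a factor
-- x_ab of M, or v = φ₁(χ(s,u,t)) for u ∈ I ∩ prec(J̄).
VertexOfΦΔ : ∀ {n} → Subset n → Subset n → Mono n → Point n → Set
VertexOfΦΔ {n} I J M v =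
  (Σ[ a ∈ Fin n ] Σ[ b ∈ Fin n ] (1 ≤ xe M a b
     × Σ[ path ∈ Star (GEdge I J) a b ] Σ[ j ∈ Fin n ]
         (j ∈ J × Prec I J j b
          × v ≈P φ₁χ (sE a ∷ (pathEdges path ++ (tE j ∷ []))))))
  ⊎ (Σ[ u ∈ Fin n ] (u ∈ I × Σ[ j ∈ Fin n ] (j ∈ J × Prec I J j u
       × v ≈P φ₁χ (sE u ∷ tE j ∷ []))))

{-# OPTIONS --safe #-}
module Submission where

open import Defs
open import Data.Nat using (ℕ)
open import Data.Nat.Properties using (+-identityʳ)
open import Data.Fin using (Fin)
open import Data.Fin.Subset using (Subset; _∈_)
open import Data.List using ([]; _∷_)
open import Data.Product using (_,_)
open import Data.Sum using (inj₂)
open import Relation.Binary.PropositionalEquality using (_≡_; sym)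
import Data.List.Membership.Propositional as Mem

φ₁χ-shortRoute : ∀ {n} (u j : Fin n) → (𝐞 u , 𝐞 j) ≈P φ₁χ (sE u ∷ tE j ∷ [])
φ₁χ-shortRoute u j = (λ x → sym (+-identityʳ (𝐞 u x))) , (λ x → sym (+-identityʳ (𝐞 j x)))

shortRoute-vertexOfΦΔ : ∀ {n} {I J : Subset n} (M : Mono n) {u j : Fin n}
  → u ∈ I → j ∈ J → Prec I J j u → VertexOfΦΔ I J M (𝐞 u , 𝐞 j)
shortRoute-vertexOfΦΔ M {u} {j} u∈I j∈J prec =
  inj₂ (u , u∈I , j , j∈J , prec , φ₁χ-shortRoute u j)

-- Every Δ_M contains χ(s,u,t) for all u ∈ I ∩ prec(J̄), whatever M is.
corollary3p12 : ∀ {n : ℕ} (I J : Subset n) → Valid I J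
    → (i j : Fin n) → i ∈ I → j ∈ J → Prec I J j i
    → (M₀ : Mono n) → IsMG I J M₀
    → (p : Poly n) → ReducedFormOf M₀ p
    → (M : Mono n) → M Mem.∈ p → βe M ≡ 0
    → VertexOfΦΔ I J M (𝐞 i , 𝐞 j)
corollary3p12 I J _ i j i∈I j∈J prec _ _ _ _ M _ _ =
  shortRoute-vertexOfΦΔ M i∈I j∈J prec
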